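{- (Upward derivability for the liability fragment of CL.) Let $\gamma$ be an elementary disjunction, $NI$ a finite index set, and for each $i\in NI$ let $A_i$ be a coalition and $\phi_i\in\Phi_{\mathsf{CL}_{LI}}$. Suppose that either $\vdash_{\mathsf{CL}_{LI}}\gamma$, or there is a subset $NI'\subseteq NI$ with $A_i\cap A_{i'}=\emptyset$ for all distinct $i,i'\in NI'$ and $\vdash_{\mathsf{CL}_{LI}}\bigvee_{i\in NI'}\phi_i$. Then $\vdash_{\mathsf{CL}_{LI}}\gamma\vee\bigvee_{i\in NI}[A_i]\phi_i$.
   Context: Fix a nonempty finite set $Ag$ of agents and a countable set $AP$ of atoms; a coalition is a subset of $Ag$. $\Phi_{\mathsf{CL}_{LI}}$: $\phi::=\top\mid\bot\mid p\mid\neg p\mid(\phi\wedge\phi)\mid(\phi\vee\phi)\mid[A]\phi$ ($p\in AP$, $A$ a coalition). An elementary disjunction is a disjunction of literals (atoms or negated atoms); the empty disjunction is $\bot$. $\vdash_{\mathsf{CL}_{LI}}\phi$ means $\phi$ is derivable in the system whose axioms are the propositional tautologies in $\Phi_{\mathsf{CL}_{LI}}$ and whose rules are: R1: from $\phi_1,\dots,\phi_n$ infer $\psi$ where $(\phi_1\wedge\dots\wedge\phi_n)\to\psi$ is a propositional tautology; R2: from $\phi$ infer $[A]\phi$; R3: from $[A\cup B](\phi\vee\psi)\vee\chi$ infer $[A]\phi\vee[B]\psi\vee\chi$, where $A\cap B=\emptyset$. -}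

module Defs where

open import Data.Nat using (ℕ; suc)
open import Data.Bool using (Bool; true; false; _∧_; _∨_; not)
open import Data.Fin using (Fin; zero; suc)
open import Data.Fin.Subset using (Subset; _∩_; _∪_; Empty; _∈_)
open import Data.List using (List; []; _∷_; map; allFin)
open import Data.List.Relation.Unary.All using (All)
open import Data.Vec using ([]; _∷_)
open import Relation.Binary.PropositionalEquality using (_≡_; _≢_)

-- Agents: Fin n (the statement takes n = suc m, so Ag is nonempty and finite).
-- Atoms: ℕ (countable).  Coalitions: Subset n.

Coalition : ℕ → Set
Coalition n = Subset n

data Fm (n : ℕ) : Set where
  ⊤'   : Fm n
  ⊥'   : Fm n
  atm  : ℕ → Fm n
  natm : ℕ → Fm n
  _∧'_ : Fm n → Fm n → Fm n
  _∨'_ : Fm n → Fm n → Fm n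
  [_]_ : Coalition n → Fm n → Fm n

infixr 6 _∧'_
infixr 5 _∨'_
infix 7 [_]_

-- Propositional semantics: atoms p and modal formulas [A]φ are treated as
-- propositional variables (valuations v and w respectively).
eval : ∀ {n} → (ℕ → Bool) → (Coalition n → Fm n → Bool) → Fm n → Bool
eval v w ⊤' = true
eval v w ⊥' = false
eval v w (atm p) = v p
eval v w (natm p) = not (v p)
eval v w (φ ∧' ψ) = eval v w φ ∧ eval v w ψ
eval v w (φ ∨' ψ) = eval v w φ ∨ eval v w ψ
eval v w ([ A ] φ) = w A φ

TautImp : ∀ {n} → List (Fm n) → Fm n → Set
TautImp {n} ps ψ = ∀ (v : ℕ → Bool) (w : Coalition n → Fm n → Bool) →
  All (λ φ → eval v w φ ≡ true) ps → eval v w ψ ≡ true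

Disjoint : ∀ {n} → Coalition n → Coalition n → Set
Disjoint A B = Empty (A ∩ B)

-- Derivability in CL_LI.  Axioms (propositional tautologies) are the
-- instance of R1 with no premises.
data ⊢_ {n : ℕ} : Fm n → Set where
  R1 : ∀ (ps : List (Fm n)) {ψ} → All ⊢_ ps → TautImp ps ψ → ⊢ ψ
  R2 : ∀ {A φ} → ⊢ φ → ⊢ [ A ] φ
  R3 : ∀ {A B φ ψ χ} → Disjoint A B →
       ⊢ (([ A ∪ B ] (φ ∨' ψ)) ∨' χ) →
       ⊢ ([ A ] φ ∨' [ B ] ψ ∨' χ)

infix 3 ⊢_

data ElemDisj {n : ℕ} : Fm n → Set where
  ed-⊥    : ElemDisj ⊥'
  ed-atm  : ∀ p → ElemDisj (atm p)
  ed-natm : ∀ p → ElemDisj (natm p)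
  ed-∨    : ∀ {φ ψ} → ElemDisj φ → ElemDisj ψ → ElemDisj (φ ∨' ψ)

⋁ : ∀ {n} → List (Fm n) → Fm n
⋁ [] = ⊥'
⋁ (φ ∷ φs) = φ ∨' ⋁ φs

⋁All : ∀ {n} k → (Fin k → Fm n) → Fm n
⋁All k f = ⋁ (map f (allFin k))

⋁Sub : ∀ {n k} → Subset k → (Fin k → Fm n) → Fm n
⋁Sub [] f = ⊥'
⋁Sub (true ∷ s) f = f zero ∨' ⋁Sub s (λ i → f (suc i))
⋁Sub (false ∷ s) f = ⋁Sub s (λ i → f (suc i))

{-# OPTIONS --safe #-}
-- If ⊢ ⋁_{i∈NI′} φᵢ, then R2 gives ⊢ [⋃_{i∈NI′} Aᵢ] ⋁_{i∈NI′} φᵢ, and because the Aᵢ are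
-- pairwise disjoint, R3 peels the boxes [Aᵢ]φᵢ off one at a time, giving ⊢ ⋁_{i∈NI′} [Aᵢ]φᵢ.
-- The missing disjuncts, γ and the [Aᵢ]φᵢ with i ∉ NI′, are then added by R1, for which
-- boxed formulas are propositional atoms. The case ⊢ γ is weakening alone.
module Submission where

open import Defs
open import Data.Nat using (ℕ; suc)
open import Data.Fin using (Fin; zero; suc)
open import Data.Fin.Properties using (suc-injective)
open import Data.Fin.Subset using (Subset; _∈_; _∪_)
open import Data.Fin.Subset.Properties using (x∈p∩q⁻; x∈p∩q⁺; x∈p∪q⁻)
open import Data.Bool using (Bool; true; false; _∨_)
open import Data.Bool.Properties using (∨-zeroʳ)
open import Data.Vec using ([]; _∷_)
import Data.Vec as Vec
open import Data.Sum using (_⊎_; inj₁; inj₂; [_,_]′)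
open import Data.Product using (Σ-syntax; _×_; _,_)
open import Data.List using (List; []; _∷_; _++_; map; allFin)
open import Data.List.Properties using (map-∘; ++-identityʳ)
open import Data.List.Relation.Unary.All as All using (All; []; _∷_)
import Data.List.Relation.Unary.All.Properties as All
open import Data.List.Relation.Unary.Any as Any using (Any; here; there)
open import Data.List.Relation.Unary.AllPairs using (AllPairs; []; _∷_)
open import Data.List.Relation.Unary.Unique.Propositional using (Unique)
import Data.List.Relation.Unary.Unique.Propositional.Properties as Unique
open import Data.List.Membership.Propositional using () renaming (_∈_ to _∈ₗ_)
open import Data.List.Membership.Propositional.Properties using (∈-allFin)
open import Data.List.Relation.Binary.Subset.Propositional using (_⊆_)
open import Data.List.Relation.Binary.Subset.Propositional.Properties
  using (⊆-reflexive; ⊆-reflexive-↭; ⊆-trans; Any-resp-⊆; xs⊆x∷xs)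
  renaming (map⁺ to ⊆-map⁺)
open import Data.List.Relation.Binary.Permutation.Propositional using (swap; refl)
open import Data.List.Relation.Binary.Permutation.Propositional.Properties using (shift)
open import Function using (_∘_; _on_)
open import Relation.Binary.PropositionalEquality using (_≡_; _≢_; refl; trans; cong; subst)

Holds : ∀ {n} → (ℕ → Bool) → (Coalition n → Fm n → Bool) → Fm n → Set
Holds v w φ = eval v w φ ≡ true

record _⊨_ {n} (φ ψ : Fm n) : Set where
  constructor entails
  field holds : ∀ v w → Holds v w φ → Holds v w ψ

⊢-resp-⊨ : ∀ {n} {φ ψ : Fm n} → ⊢ φ → φ ⊨ ψ → ⊢ ψ
⊢-resp-⊨ ⊢φ (entails φ⇒ψ) = R1 (_ ∷ []) (⊢φ ∷ []) (λ v w → λ { (h ∷ []) → φ⇒ψ v w h })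

module _ {n : ℕ} {v : ℕ → Bool} {w : Coalition n → Fm n → Bool} where

  ⋁-holds⁺ : ∀ {φs} → Any (Holds v w) φs → Holds v w (⋁ φs)
  ⋁-holds⁺ (here h) rewrite h = refl
  ⋁-holds⁺ (there h) rewrite ⋁-holds⁺ h = ∨-zeroʳ _

  ⋁-holds⁻ : ∀ φs → Holds v w (⋁ φs) → Any (Holds v w) φs
  ⋁-holds⁻ (φ ∷ φs) h with eval v w φ in φ-holds
  ... | true  = here φ-holds
  ... | false = there (⋁-holds⁻ φs h)

∈⇒⊨⋁ : ∀ {n} {φ : Fm n} {φs} → φ ∈ₗ φs → φ ⊨ ⋁ φs
∈⇒⊨⋁ φ∈φs = entails (λ v w h → ⋁-holds⁺ (Any.map (λ { refl → h }) φ∈φs))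

⊢⋁-⊆ : ∀ {n} {φs ψs : List (Fm n)} → φs ⊆ ψs → ⊢ ⋁ φs → ⊢ ⋁ ψs
⊢⋁-⊆ {φs = φs} φs⊆ψs ⊢⋁φs =
  ⊢-resp-⊨ ⊢⋁φs (entails (λ v w → ⋁-holds⁺ ∘ Any-resp-⊆ φs⊆ψs ∘ ⋁-holds⁻ φs))

-- No trailing ⊥' or ∅: nothing turns [A] (φ ∨' ⊥') into [A] φ, as there is no monotonicity rule.
⋁⁺ : ∀ {n} → Fm n → List (Fm n) → Fm n
⋁⁺ φ []       = φ
⋁⁺ φ (ψ ∷ ψs) = φ ∨' ⋁⁺ ψ ψs

⋃⁺ : ∀ {n} → Coalition n → List (Coalition n) → Coalition n
⋃⁺ X []       = X
⋃⁺ X (Y ∷ Ys) = X ∪ ⋃⁺ Y Ys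

⋁⊨⋁⁺ : ∀ {n} {φ : Fm n} {ψs} → ⋁ (φ ∷ ψs) ⊨ ⋁⁺ φ ψs
⋁⊨⋁⁺ {φ = φ} {ψs} = entails (λ v w → ⋁⁺-holds φ ψs ∘ ⋁-holds⁻ (φ ∷ ψs))
  where
    ⋁⁺-holds : ∀ {v w} φ ψs → Any (Holds v w) (φ ∷ ψs) → Holds v w (⋁⁺ φ ψs)
    ⋁⁺-holds φ []       (here h)  = h
    ⋁⁺-holds φ (ψ ∷ ψs) (here h)  rewrite h = refl
    ⋁⁺-holds φ (ψ ∷ ψs) (there h) rewrite ⋁⁺-holds ψ ψs h = ∨-zeroʳ _

Disjoint-∪ʳ : ∀ {n} {X Y Z : Coalition n} → Disjoint X Y → Disjoint X Z → Disjoint X (Y ∪ Z)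
Disjoint-∪ʳ {X = X} {Y} {Z} X∩Y≡∅ X∩Z≡∅ (x , x∈X∩Y∪Z) =
  let x∈X , x∈Y∪Z = x∈p∩q⁻ X (Y ∪ Z) x∈X∩Y∪Z in
  [ (λ x∈Y → X∩Y≡∅ (x , x∈p∩q⁺ (x∈X , x∈Y))) , (λ x∈Z → X∩Z≡∅ (x , x∈p∩q⁺ (x∈X , x∈Z))) ]′
    (x∈p∪q⁻ Y Z x∈Y∪Z)

Disjoint-⋃⁺ : ∀ {n} {X Y : Coalition n} {Ys} → All (Disjoint X) (Y ∷ Ys) → Disjoint X (⋃⁺ Y Ys)
Disjoint-⋃⁺ {Ys = []}     (X∩Y≡∅ ∷ []) = X∩Y≡∅
Disjoint-⋃⁺ {Ys = _ ∷ _} (X∩Y≡∅ ∷ ds) = Disjoint-∪ʳ X∩Y≡∅ (Disjoint-⋃⁺ ds)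

module _ {n : ℕ} {I : Set} (A : I → Coalition n) (φ : I → Fm n) where

  private
    [A]φ : I → Fm n
    [A]φ i = [ A i ] φ i

  -- Each R3 step splits [A i] φ i off the front box and parks it in χs, so the rest is again in front.
  R3-iterate : ∀ i is χs → AllPairs (Disjoint on A) (i ∷ is) →
    ⊢ ⋁ ([ ⋃⁺ (A i) (map A is) ] ⋁⁺ (φ i) (map φ is) ∷ χs) →
    ⊢ ⋁ (map [A]φ (i ∷ is) ++ χs)
  R3-iterate i []       χs _ ⊢⋁ = ⊢⋁
  R3-iterate i (j ∷ is) χs (dᵢ ∷ ds) ⊢⋁ =
    ⊢⋁-⊆ (⊆-reflexive-↭ (shift ([A]φ i) (map [A]φ (j ∷ is)) χs))
      (R3-iterate j is ([A]φ i ∷ χs) ds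
        (⊢⋁-⊆ (⊆-reflexive-↭ (swap _ _ refl)) (R3 (Disjoint-⋃⁺ (All.map⁺ dᵢ)) ⊢⋁)))

  ⊢⋁-box : ∀ is → AllPairs (Disjoint on A) is → ⊢ ⋁ (map φ is) → ⊢ ⋁ (map [A]φ is)
  ⊢⋁-box []       _  ⊢⊥ = ⊢⊥
  ⊢⋁-box (i ∷ is) ds ⊢⋁φ =
    ⊢⋁-⊆ (⊆-reflexive (++-identityʳ _)) (R3-iterate i is [] ds ⊢[⋃]⋁⁺)
    where
      ⊢⋁⁺ : ⊢ ⋁⁺ (φ i) (map φ is)
      ⊢⋁⁺ = ⊢-resp-⊨ ⊢⋁φ ⋁⊨⋁⁺

      ⊢[⋃]⋁⁺ : ⊢ ⋁ ([ ⋃⁺ (A i) (map A is) ] ⋁⁺ (φ i) (map φ is) ∷ [])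
      ⊢[⋃]⋁⁺ = ⊢-resp-⊨ (R2 ⊢⋁⁺) (∈⇒⊨⋁ (here refl))

AllPairs-restrict : ∀ {A : Set} {P : A → Set} {R T : A → A → Set} →
  (∀ {x y} → P x → P y → R x y → T x y) →
  ∀ {xs} → All P xs → AllPairs R xs → AllPairs T xs
AllPairs-restrict R⇒T []         []         = []
AllPairs-restrict R⇒T (px ∷ pxs) (rx ∷ rxs) =
  All.zipWith (λ (py , r) → R⇒T px py r) (pxs , rx) ∷ AllPairs-restrict R⇒T pxs rxs

elements : ∀ {k} → Subset k → List (Fin k)
elements []          = []
elements (true ∷ S)  = zero ∷ map suc (elements S)
elements (false ∷ S) = map suc (elements S)

elements-∈ : ∀ {k} (S : Subset k) → All (_∈ S) (elements S)
elements-∈ []          = []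
elements-∈ (true ∷ S)  = Vec.here ∷ All.map⁺ (All.map Vec.there (elements-∈ S))
elements-∈ (false ∷ S) = All.map⁺ (All.map Vec.there (elements-∈ S))

elements-unique : ∀ {k} (S : Subset k) → Unique (elements S)
elements-unique []          = []
elements-unique (true ∷ S)  =
  All.map⁺ (All.universal (λ _ ()) (elements S)) ∷ Unique.map⁺ suc-injective (elements-unique S)
elements-unique (false ∷ S) = Unique.map⁺ suc-injective (elements-unique S)

⋁Sub-elements : ∀ {n k} (S : Subset k) (f : Fin k → Fm n) → ⋁Sub S f ≡ ⋁ (map f (elements S))
⋁Sub-elements []          f = refl
⋁Sub-elements (true ∷ S)  f =
  cong (f zero ∨'_) (trans (⋁Sub-elements S (f ∘ suc)) (cong ⋁ (map-∘ (elements S))))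
⋁Sub-elements (false ∷ S) f = trans (⋁Sub-elements S (f ∘ suc)) (cong ⋁ (map-∘ (elements S)))

-- The argument works for any γ.
mainTheorem11 : ∀ (m : ℕ) (γ : Fm (suc m)) → ElemDisj γ →
    ∀ (k : ℕ) (A : Fin k → Coalition (suc m)) (φ : Fin k → Fm (suc m)) →
    ((⊢ γ) ⊎
     (Σ[ NI′ ∈ Subset k ]
        ((∀ i j → i ∈ NI′ → j ∈ NI′ → i ≢ j → Disjoint (A i) (A j)) ×
         (⊢ ⋁Sub NI′ φ)))) →
    ⊢ (γ ∨' ⋁All k (λ i → [ A i ] φ i))
mainTheorem11 m γ _ k A φ (inj₁ ⊢γ) = ⊢-resp-⊨ ⊢γ (∈⇒⊨⋁ (here refl))
mainTheorem11 m γ _ k A φ (inj₂ (NI′ , disjoint , ⊢⋁φ)) =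
  ⊢⋁-⊆ NI′⊆γ∷NI
    (⊢⋁-box A φ (elements NI′) pairwise-disjoint (subst ⊢_ (⋁Sub-elements NI′ φ) ⊢⋁φ))
  where
    pairwise-disjoint : AllPairs (Disjoint on A) (elements NI′)
    pairwise-disjoint =
      AllPairs-restrict (disjoint _ _) (elements-∈ NI′) (elements-unique NI′)

    NI′⊆γ∷NI : map (λ i → [ A i ] φ i) (elements NI′) ⊆ γ ∷ map (λ i → [ A i ] φ i) (allFin k)
    NI′⊆γ∷NI = ⊆-trans (⊆-map⁺ _ (λ {i} _ → ∈-allFin i)) (xs⊆x∷xs _ γ)
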